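{- Let $(X,A,f,\alpha)$ be an invertible micro-macro dynamical system. Then $D=\emptyset$ (entropy is always increasing in the weak sense) if and only if the entropy $S$ is constant on every $\alpha$-orbit.
   Context: An invertible micro-macro dynamical system: $X,A$ finite sets, $f:X\to A$ surjective, $\alpha:X\to X$ a bijection. For $i\in X$, $S(i)=\ln|f^{ -1}(f(i))|$. $D=\{i\in X:S(\alpha(i))<S(i)\}$. -}

module Defs where

open import Data.Nat using (ℕ; zero; suc; _<_)
open import Data.Integer using (ℤ; +_; -[1+_])
open import Data.Fin using (Fin; _≟_)
open import Data.List using (length; filter)
open import Data.List.Base using ()
open import Data.Fin.Base using ()
open import Data.List using (List)
open import Data.Product using (∃; Σ)
open import Function.Bundles using (_↔_; Inverse)
open import Relation.Binary.PropositionalEquality using (_≡_)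
open import Relation.Nullary using (¬_)
import Data.List as L
import Data.Fin as F

-- A micro-macro dynamical system: X = Fin n, A = Fin m (finite sets, up to
-- bijection), f : X → A surjective, α : X ↔ X a bijection (with inverse).
record MicroMacro (n m : ℕ) : Set where
  field
    f      : Fin n → Fin m
    f-surj : ∀ (a : Fin m) → ∃ λ (x : Fin n) → f x ≡ a
    α      : Fin n ↔ Fin n

open MicroMacro public

allX : (n : ℕ) → List (Fin n)
allX n = L.allFin n

fiberSize : {n m : ℕ} → (Fin n → Fin m) → Fin n → ℕ
fiberSize {n} f i = length (filter (λ j → f j ≟ f i) (allX n))

S : {n m : ℕ} → MicroMacro n m → Fin n → ℕ
S sys = fiberSize (f sys)

iter : {n : ℕ} → (Fin n → Fin n) → ℕ → Fin n → Fin n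
iter g zero x = x
iter g (suc k) x = g (iter g k x)

pow : {n : ℕ} → Fin n ↔ Fin n → ℤ → Fin n → Fin n
pow α (+ k) = iter (Inverse.to α) k
pow α -[1+ k ] = iter (Inverse.from α) (suc k)

InD : {n m : ℕ} → MicroMacro n m → Fin n → Set
InD sys i = S sys (Inverse.to (α sys) i) < S sys i

DEmpty : {n m : ℕ} → MicroMacro n m → Set
DEmpty sys = ∀ i → ¬ InD sys i

InOrbit : {n m : ℕ} → MicroMacro n m → Fin n → Fin n → Set
InOrbit sys i j = ∃ λ (k : ℤ) → pow (α sys) k i ≡ j

SConstOnOrbits : {n m : ℕ} → MicroMacro n m → Set
SConstOnOrbits sys = ∀ i j → InOrbit sys i j → S sys i ≡ S sys j

{-# OPTIONS --safe #-}
module Submission where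

-- If D = ∅ then S ≤ S ∘ α pointwise. As α permutes X, the totals Σᵢ S(i) and
-- Σᵢ S(α i) agree, so a pointwise inequality between them must be an equality:
-- S ∘ α = S, and S is invariant under every power of α. Conversely α(i) lies
-- in the orbit of i, so constancy on orbits rules out S(α i) < S(i).

open import Defs
open import Data.Nat using (ℕ; zero; suc; _+_; _≤_; z≤n)
open import Data.Nat.Properties
  using (+-0-commutativeMonoid; +-mono-≤; +-mono-<-≤; +-cancelˡ-≡; m≤n⇒m<n∨m≡n; <⇒≢; <-irrefl; ≮⇒≥)
open import Data.Integer using (+_; -[1+_])
open import Data.Fin using (Fin)
open import Data.Sum using (inj₁; inj₂)
open import Data.Product using (_×_; _,_)
open import Function.Bundles using (_⇔_; _↔_; mk⇔; Inverse)
open import Relation.Binary.PropositionalEquality using (_≡_; _≗_; refl; sym; trans; cong)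
open import Relation.Nullary using (contradiction)
open import Algebra.Properties.CommutativeMonoid.Sum +-0-commutativeMonoid using (sum; ∑-permute)

+-≤-≡⇒≡ : ∀ {a b c d} → a ≤ b → c ≤ d → a + c ≡ b + d → a ≡ b × c ≡ d
+-≤-≡⇒≡ {a} a≤b c≤d a+c≡b+d with m≤n⇒m<n∨m≡n a≤b
... | inj₁ a<b  = contradiction a+c≡b+d (<⇒≢ (+-mono-<-≤ a<b c≤d))
... | inj₂ refl = refl , +-cancelˡ-≡ a _ _ a+c≡b+d

sum-mono-≤ : ∀ {n} {g h : Fin n → ℕ} → (∀ i → g i ≤ h i) → sum g ≤ sum h
sum-mono-≤ {zero}  g≤h = z≤n
sum-mono-≤ {suc n} g≤h = +-mono-≤ (g≤h Fin.zero) (sum-mono-≤ (λ i → g≤h (Fin.suc i)))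

sum-≤-≡⇒≗ : ∀ {n} {g h : Fin n → ℕ} → (∀ i → g i ≤ h i) → sum g ≡ sum h → g ≗ h
sum-≤-≡⇒≗ {suc n} g≤h Σg≡Σh i with +-≤-≡⇒≡ (g≤h Fin.zero) (sum-mono-≤ (λ i → g≤h (Fin.suc i))) Σg≡Σh
sum-≤-≡⇒≗ {suc n} g≤h Σg≡Σh Fin.zero    | g₀≡h₀ , _     = g₀≡h₀
sum-≤-≡⇒≗ {suc n} g≤h Σg≡Σh (Fin.suc i) | _     , Σ≡Σ   = sum-≤-≡⇒≗ (λ i → g≤h (Fin.suc i)) Σ≡Σ i

≤-along-permutation⇒invariant : ∀ {n} (π : Fin n ↔ Fin n) (g : Fin n → ℕ) →
  (∀ i → g i ≤ g (Inverse.to π i)) → ∀ i → g (Inverse.to π i) ≡ g i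
≤-along-permutation⇒invariant π g g≤g∘π i =
  sym (sum-≤-≡⇒≗ g≤g∘π (∑-permute g π) i)

iter-invariant : ∀ {n} {B : Set} (h : Fin n → Fin n) (g : Fin n → B) →
  (∀ x → g (h x) ≡ g x) → ∀ k x → g (iter h k x) ≡ g x
iter-invariant h g g∘h≗g zero    x = refl
iter-invariant h g g∘h≗g (suc k) x = trans (g∘h≗g _) (iter-invariant h g g∘h≗g k x)

pow-invariant : ∀ {n} {B : Set} (π : Fin n ↔ Fin n) (g : Fin n → B) →
  (∀ x → g (Inverse.to π x) ≡ g x) → ∀ k x → g (pow π k x) ≡ g x
pow-invariant π g g∘π≗g (+ k)    = iter-invariant (Inverse.to π) g g∘π≗g k
pow-invariant π g g∘π≗g -[1+ k ] = iter-invariant (Inverse.from π) g g∘π⁻¹≗g (suc k)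
  where
  g∘π⁻¹≗g : ∀ x → g (Inverse.from π x) ≡ g x
  g∘π⁻¹≗g x = trans (sym (g∘π≗g _)) (cong g (Inverse.strictlyInverseˡ π x))

mainTheorem9 : (n m : ℕ) (sys : MicroMacro n m) → DEmpty sys ⇔ SConstOnOrbits sys
mainTheorem9 n m sys = mk⇔ constOnOrbits noDecrease
  where
  constOnOrbits : DEmpty sys → SConstOnOrbits sys
  constOnOrbits D≡∅ i j (k , αᵏi≡j) =
    trans (sym (pow-invariant (α sys) (S sys) S∘α≗S k i)) (cong (S sys) αᵏi≡j)
    where
    S∘α≗S : ∀ x → S sys (Inverse.to (α sys) x) ≡ S sys x
    S∘α≗S = ≤-along-permutation⇒invariant (α sys) (S sys) (λ x → ≮⇒≥ (D≡∅ x))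

  noDecrease : SConstOnOrbits sys → DEmpty sys
  noDecrease const i = <-irrefl (sym (const i _ (+ 1 , refl)))
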